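{- Let $A$ be a proper Latin square of order $n$, let $i_1\ne i_2$ be rows, let $r\ge 2$ and let $j_1,\dots,j_r$ be distinct columns such that, writing $x_k$ for the symbol in cell $(i_1,j_k)$, the cell $(i_2,j_k)$ contains $x_{k+1}$ for $1\le k\le r-1$ and the cell $(i_2,j_r)$ contains $x_1$. Then there is a sequence of exactly $r-1$ $\pm1$-moves, each producing an element of $S$ and acting only on the cells $(i_1,j_k),(i_2,j_k)$, $1\le k\le r$, which transforms $A$ into the proper Latin square $A'$ that agrees with $A$ outside these $2r$ cells and in which cell $(i_1,j_k)$ contains $x_{k+1}$ for $1\le k\le r-1$, cell $(i_1,j_r)$ contains $x_1$, and cell $(i_2,j_k)$ contains $x_k$ for $1\le k\le r$.
   Context: Let $[n]=\{1,\dots,n\}$ index rows, columns and symbols. A proper or improper Latin square of order $n$ is a function $f:[n]^3\to\mathbb{Z}$ such that for every two fixed coordinates the sum over the third coordinate equals $1$, and either all values lie in $\{0,1\}$ (proper Latin square; equivalently an ordinary Latin square $L$ with $f(i,j,k)=1$ iff $L_{ij}=k$, and we say cell $(i,j)$ contains $k$), or exactly one value equals $-1$ and all others lie in $\{0,1\}$ (improper Latin square). $S$ denotes the set of all proper and improper Latin squares of order $n$. A $\pm1$-move replaces $f\in S$ by $f+\Delta$ with $\Delta=e_{(i,j,a)}+e_{(i,j',b)}+e_{(i',j,b)}+e_{(i',j',a)}-e_{(i,j,b)}-e_{(i,j',a)}-e_{(i',j,a)}-e_{(i',j',b)}$ for some $i\ne i'$, $j\ne j'$, $a\ne b$ ($e$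 denotes indicator functions), provided $f+\Delta\in S$; it changes only cells $(i,j),(i,j'),(i',j),(i',j')$. -}

module Defs where

open import Data.Nat using (ℕ; zero; suc; _<_)
open import Data.Nat.Properties using (_<?_)
open import Data.Fin using (Fin; zero; suc; toℕ; fromℕ<; _≟_)
open import Data.Integer using (ℤ; +_; -[1+_]; _+_; _-_)
open import Data.Product using (Σ; ∃; _×_; _,_)
open import Data.Sum using (_⊎_)
open import Relation.Nullary using (¬_; yes; no)
open import Relation.Binary.PropositionalEquality using (_≡_; _≢_)

-- A function [n]^3 → ℤ  (row, column, symbol)
Sq : ℕ → Set
Sq n = Fin n → Fin n → Fin n → ℤ

sumFin : ∀ {n} → (Fin n → ℤ) → ℤ
sumFin {zero} f = + 0
sumFin {suc n} f = f zero + sumFin (λ k → f (suc k))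

LineSums : ∀ {n} → Sq n → Set
LineSums f =
  (∀ i j → sumFin (λ k → f i j k) ≡ + 1) ×
  (∀ i k → sumFin (λ j → f i j k) ≡ + 1) ×
  (∀ j k → sumFin (λ i → f i j k) ≡ + 1)

ZeroOne : ℤ → Set
ZeroOne v = (v ≡ + 0) ⊎ (v ≡ + 1)

Proper : ∀ {n} → Sq n → Set
Proper f = LineSums f × (∀ i j k → ZeroOne (f i j k))

Improper : ∀ {n} → Sq n → Set
Improper {n} f = LineSums f ×
  Σ (Fin n) λ i₀ → Σ (Fin n) λ j₀ → Σ (Fin n) λ k₀ →
    (f i₀ j₀ k₀ ≡ -[1+ 0 ]) ×
    (∀ i j k → ¬ (i ≡ i₀ × j ≡ j₀ × k ≡ k₀) → ZeroOne (f i j k))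

InS : ∀ {n} → Sq n → Set
InS f = Proper f ⊎ Improper f

e : ∀ {n} → Fin n → Fin n → Fin n → Sq n
e i j a x y z with x ≟ i | y ≟ j | z ≟ a
... | yes _ | yes _ | yes _ = + 1
... | _ | _ | _ = + 0

Δ : ∀ {n} → (i i' j j' a b : Fin n) → Sq n
Δ i i' j j' a b x y z =
  (e i j a x y z + e i j' b x y z + e i' j b x y z + e i' j' a x y z)
  - (e i j b x y z + e i j' a x y z + e i' j a x y z + e i' j' b x y z)

MoveWith : ∀ {n} → (i i' j j' a b : Fin n) → Sq n → Sq n → Set
MoveWith i i' j j' a b f g =
  i ≢ i' × j ≢ j' × a ≢ b ×
  (∀ x y z → g x y z ≡ f x y z + Δ i i' j j' a b x y z) ×
  InS g

data Steps {A : Set} (R : A → A → Set) : ℕ → A → A → Set where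
  done : ∀ {f} → Steps R zero f f
  step : ∀ {k f g h} → R f g → Steps R k g h → Steps R (suc k) f h

-- cyclic successor on Fin r :  k ↦ k+1 (0-indexed), last ↦ 0
cyc : ∀ {r} → Fin r → Fin r
cyc {suc m} k with suc (toℕ k) <? suc m
... | yes p = fromℕ< p
... | no _ = zero

BlockMove : ∀ {n r} → (i₁ i₂ : Fin n) → (cols : Fin r → Fin n) → Sq n → Sq n → Set
BlockMove {n} {r} i₁ i₂ cols f g =
  Σ (Fin n) λ i → Σ (Fin n) λ i' → Σ (Fin n) λ j → Σ (Fin n) λ j' →
  Σ (Fin n) λ a → Σ (Fin n) λ b →
    ((i ≡ i₁ × i' ≡ i₂) ⊎ (i ≡ i₂ × i' ≡ i₁)) ×
    (∃ λ (k : Fin r) → j ≡ cols k) ×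
    (∃ λ (k : Fin r) → j' ≡ cols k) ×
    MoveWith i i' j j' a b f g

InBlock : ∀ {n r} → (i₁ i₂ : Fin n) → (cols : Fin r → Fin n) → Fin n → Fin n → Set
InBlock {n} {r} i₁ i₂ cols i j = (i ≡ i₁ ⊎ i ≡ i₂) × (∃ λ (k : Fin r) → j ≡ cols k)

-- Index the columns and symbols of the cycle from 0, so that row i₁ reads x m and row i₂ reads
-- x (m+1) in column m, indices taken mod r. The t-th move (t = 0, …, r-2) acts on columns t and t+1
-- with symbols x (t+1) and x 0. Its increment factorises as (δ i₁ − δ i₂)(δ j − δ j')(δ a − δ b),
-- so it preserves every line sum and changes rows i₁ and i₂ by opposite amounts. After t moves
-- row i₁ reads x (m+1) in the finished columns m < t, x 0 in the active column t and x m beyond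
-- it; row i₂ is the original column total minus row i₁, so for 0 < t < r-1 its only entry outside
-- {0,1} is −1 at symbol x 0 in column t. In the last column x (t+1) wraps around to x 0 and that
-- entry cancels.
module Submission where

open import Defs
open import Data.Nat using (ℕ; zero; suc; _≤_; _<_; _∸_; s≤s; z≤n)
open import Data.Nat.Properties
  using ( _<?_; <-cmp; <-irrefl; <-trans; <⇒≱; <⇒≢; ≤-trans; ≤-refl; ≤-pred; n≤1+n; n<1+n
        ; ≤∧≢⇒<; 1+n≢n; 1+n≢0)
  renaming (_≟_ to _≟ℕ_)
open import Data.Fin using (Fin; zero; suc; toℕ; _≟_)
open import Data.Fin.Properties using (toℕ-injective; toℕ-fromℕ<; toℕ<n; suc-injective; any?)
open import Data.Integer using (ℤ; +_; -[1+_]; _+_; _-_; _*_; -_; +≤+) renaming (_≤_ to _≤ℤ_)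
import Data.Integer.Properties as ℤ
open import Data.Integer.Tactic.RingSolver using (solve-∀)
open import Data.Product using (Σ; _×_; _,_; proj₁; proj₂)
open import Data.Sum using (inj₁; inj₂; [_,_])
open import Data.Empty using (⊥-elim)
open import Function using (_∘_)
open import Relation.Nullary using (¬_; yes; no)
open import Relation.Nullary.Decidable using (_⊎-dec_)
open import Relation.Binary.Definitions using (tri<; tri≈; tri>)
open import Relation.Binary.PropositionalEquality
  using (_≡_; _≢_; refl; sym; trans; cong; cong₂; subst; subst₂; module ≡-Reasoning)

δ : ∀ {n} → Fin n → Fin n → ℤ
δ u v with u ≟ v
... | yes _ = + 1
... | no _  = + 0

δ-≡ : ∀ {n} {u v : Fin n} → u ≡ v → δ u v ≡ + 1
δ-≡ {u = u} {v} u≡v with u ≟ v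
... | yes _   = refl
... | no u≢v  = ⊥-elim (u≢v u≡v)

δ-≢ : ∀ {n} {u v : Fin n} → u ≢ v → δ u v ≡ + 0
δ-≢ {u = u} {v} u≢v with u ≟ v
... | yes u≡v = ⊥-elim (u≢v u≡v)
... | no _    = refl

δ-ZeroOne : ∀ {n} (u v : Fin n) → ZeroOne (δ u v)
δ-ZeroOne u v with u ≟ v
... | yes _ = inj₂ refl
... | no _  = inj₁ refl

δ-map-injective : ∀ {m n} {g : Fin m → Fin n} → (∀ k k' → g k ≡ g k' → k ≡ k') →
  ∀ u v → δ (g u) (g v) ≡ δ u v
δ-map-injective {g = g} g-injective u v with u ≟ v
... | yes u≡v = δ-≡ (cong g u≡v)
... | no u≢v  = δ-≢ (u≢v ∘ g-injective u v)

δ+δ-δ-ZeroOne : ∀ {n} {a b c z : Fin n} → a ≢ b → z ≢ c → ZeroOne (δ z a + δ z b - δ z c)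
δ+δ-δ-ZeroOne {a = a} {b} {z = z} a≢b z≢c rewrite δ-≢ z≢c with z ≟ a | z ≟ b
... | yes refl | yes refl = ⊥-elim (a≢b refl)
... | yes _    | no _     = inj₂ refl
... | no _     | yes _    = inj₂ refl
... | no _     | no _     = inj₁ refl

e≡δ-product : ∀ {n} (i j a x y z : Fin n) → e i j a x y z ≡ δ x i * (δ y j * δ z a)
e≡δ-product i j a x y z with x ≟ i | y ≟ j | z ≟ a
... | yes _ | yes _ | yes _ = refl
... | no _  | _     | _     = refl
... | yes _ | no _  | _     = refl
... | yes _ | yes _ | no _  = refl

δ± : ∀ {n} → Fin n → Fin n → Fin n → ℤ
δ± u v w = δ u v - δ u w

δ±-≡≢ : ∀ {n} {u v w : Fin n} → u ≡ v → u ≢ w → δ± u v w ≡ + 1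
δ±-≡≢ u≡v u≢w = cong₂ _-_ (δ-≡ u≡v) (δ-≢ u≢w)

δ±-≢≡ : ∀ {n} {u v w : Fin n} → u ≢ v → u ≡ w → δ± u v w ≡ - + 1
δ±-≢≡ u≢v u≡w = cong₂ _-_ (δ-≢ u≢v) (δ-≡ u≡w)

δ±-≢≢ : ∀ {n} {u v w : Fin n} → u ≢ v → u ≢ w → δ± u v w ≡ + 0
δ±-≢≢ u≢v u≢w = cong₂ _-_ (δ-≢ u≢v) (δ-≢ u≢w)

Δ≡δ±-product : ∀ {n} (i i' j j' a b x y z : Fin n) →
  Δ i i' j j' a b x y z ≡ δ± x i i' * (δ± y j j' * δ± z a b)
Δ≡δ±-product i i' j j' a b x y z
  rewrite e≡δ-product i j a x y z | e≡δ-product i j' b x y z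
        | e≡δ-product i' j b x y z | e≡δ-product i' j' a x y z
        | e≡δ-product i j b x y z | e≡δ-product i j' a x y z
        | e≡δ-product i' j a x y z | e≡δ-product i' j' b x y z
  = expand (δ x i) (δ x i') (δ y j) (δ y j') (δ z a) (δ z b)
  where
  expand : ∀ X X' Y Y' P Q →
    (X * (Y * P) + X * (Y' * Q) + X' * (Y * Q) + X' * (Y' * P))
      - (X * (Y * Q) + X * (Y' * P) + X' * (Y * P) + X' * (Y' * Q))
    ≡ (X - X') * ((Y - Y') * (P - Q))
  expand = solve-∀

sumFin-cong : ∀ {n} {f g : Fin n → ℤ} → (∀ k → f k ≡ g k) → sumFin f ≡ sumFin g
sumFin-cong {zero}  _   = refl
sumFin-cong {suc n} f≗g = cong₂ _+_ (f≗g zero) (sumFin-cong (f≗g ∘ suc))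

sumFin-zero : ∀ {n} {f : Fin n → ℤ} → (∀ k → f k ≡ + 0) → sumFin f ≡ + 0
sumFin-zero {zero}  _   = refl
sumFin-zero {suc n} f≗0 = cong₂ _+_ (f≗0 zero) (sumFin-zero (f≗0 ∘ suc))

sumFin-distrib-+ : ∀ {n} (f g : Fin n → ℤ) → sumFin (λ k → f k + g k) ≡ sumFin f + sumFin g
sumFin-distrib-+ {zero}  f g = refl
sumFin-distrib-+ {suc n} f g =
  trans (cong (_+_ (f zero + g zero)) (sumFin-distrib-+ (f ∘ suc) (g ∘ suc)))
        (interchange (f zero) (g zero) _ _)
  where
  interchange : ∀ a b c d → (a + b) + (c + d) ≡ (a + c) + (b + d)
  interchange = solve-∀

sumFin-distrib-minus : ∀ {n} (f g : Fin n → ℤ) → sumFin (λ k → f k - g k) ≡ sumFin f - sumFin g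
sumFin-distrib-minus {zero}  f g = refl
sumFin-distrib-minus {suc n} f g =
  trans (cong (_+_ (f zero - g zero)) (sumFin-distrib-minus (f ∘ suc) (g ∘ suc)))
        (interchange (f zero) (g zero) _ _)
  where
  interchange : ∀ a b c d → (a - b) + (c - d) ≡ (a + c) - (b + d)
  interchange = solve-∀

*-distribˡ-sumFin : ∀ {n} c (f : Fin n → ℤ) → c * sumFin f ≡ sumFin (λ k → c * f k)
*-distribˡ-sumFin {zero}  c f = ℤ.*-zeroʳ c
*-distribˡ-sumFin {suc n} c f =
  trans (ℤ.*-distribˡ-+ c (f zero) _) (cong (_+_ (c * f zero)) (*-distribˡ-sumFin c (f ∘ suc)))

sumFin-δ : ∀ {n} (v : Fin n) → sumFin (λ u → δ u v) ≡ + 1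
sumFin-δ {suc n} zero =
  cong₂ _+_ (δ-≡ {u = zero {n}} refl) (sumFin-zero {n} (λ k → δ-≢ {u = suc k} {zero} λ ()))
sumFin-δ (suc v) = begin
  δ zero (suc v) + sumFin (λ k → δ (suc k) (suc v))
    ≡⟨ cong₂ _+_ (δ-≢ {u = zero} {suc v} λ ())
                 (sumFin-cong (λ k → δ-map-injective (λ _ _ → suc-injective) k v)) ⟩
  + 0 + sumFin (λ k → δ k v)  ≡⟨ ℤ.+-identityˡ _ ⟩
  sumFin (λ k → δ k v)        ≡⟨ sumFin-δ v ⟩
  + 1                         ∎
  where open ≡-Reasoning

sumFin-multiple-δ± : ∀ {n} {f : Fin n → ℤ} c v w → (∀ u → f u ≡ c * δ± u v w) → sumFin f ≡ + 0
sumFin-multiple-δ± {f = f} c v w f≗cδ± = begin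
  sumFin f                       ≡⟨ sumFin-cong f≗cδ± ⟩
  sumFin (λ u → c * δ± u v w)    ≡⟨ sym (*-distribˡ-sumFin c (λ u → δ± u v w)) ⟩
  c * sumFin (λ u → δ± u v w)    ≡⟨ cong (c *_) (sumFin-distrib-minus (λ u → δ u v) (λ u → δ u w)) ⟩
  c * (sumFin (λ u → δ u v) - sumFin (λ u → δ u w))
                                 ≡⟨ cong (c *_) (cong₂ _-_ (sumFin-δ v) (sumFin-δ w)) ⟩
  c * + 0                        ≡⟨ ℤ.*-zeroʳ c ⟩
  + 0                            ∎
  where open ≡-Reasoning

LineSums-+Δ : ∀ {n} {f g : Sq n} (i i' j j' a b : Fin n) → LineSums f →
  (∀ x y z → g x y z ≡ f x y z + Δ i i' j j' a b x y z) → LineSums g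
LineSums-+Δ i i' j j' a b (cells , rows , columns) g≡f+Δ =
  (λ x y → line (g≡f+Δ x y) (cells x y)
    (sumFin-multiple-δ± (δ± x i i' * δ± y j j') a b
      (λ z → trans (Δ≡δ±-product i i' j j' a b x y z)
                   (sym (ℤ.*-assoc (δ± x i i') (δ± y j j') (δ± z a b)))))) ,
  (λ x z → line (λ y → g≡f+Δ x y z) (rows x z)
    (sumFin-multiple-δ± (δ± x i i' * δ± z a b) j j'
      (λ y → trans (Δ≡δ±-product i i' j j' a b x y z)
                   (swap₂₃ (δ± x i i') (δ± y j j') (δ± z a b))))) ,
  (λ y z → line (λ x → g≡f+Δ x y z) (columns y z)
    (sumFin-multiple-δ± (δ± y j j' * δ± z a b) i i'
      (λ x → trans (Δ≡δ±-product i i' j j' a b x y z)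
                   (ℤ.*-comm (δ± x i i') (δ± y j j' * δ± z a b)))))
  where
  swap₂₃ : ∀ X Y Z → X * (Y * Z) ≡ (X * Z) * Y
  swap₂₃ = solve-∀
  line : ∀ {n} {g f h : Fin n → ℤ} → (∀ u → g u ≡ f u + h u) →
    sumFin f ≡ + 1 → sumFin h ≡ + 0 → sumFin g ≡ + 1
  line {f = f} {h} g≗f+h Σf≡1 Σh≡0 =
    trans (sumFin-cong g≗f+h) (trans (sumFin-distrib-+ f h) (cong₂ _+_ Σf≡1 Σh≡0))

ZeroOne⇒0≤ : ∀ {v} → ZeroOne v → + 0 ≤ℤ v
ZeroOne⇒0≤ (inj₁ refl) = +≤+ z≤n
ZeroOne⇒0≤ (inj₂ refl) = +≤+ z≤n

sumFin-nonneg : ∀ {n} {f : Fin n → ℤ} → (∀ k → + 0 ≤ℤ f k) → + 0 ≤ℤ sumFin f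
sumFin-nonneg {zero}  _   = +≤+ z≤n
sumFin-nonneg {suc n} f≥0 = ℤ.+-mono-≤ (f≥0 zero) (sumFin-nonneg (f≥0 ∘ suc))

i≤i+nonneg : ∀ i {j} → + 0 ≤ℤ j → i ≤ℤ i + j
i≤i+nonneg i 0≤j = ℤ.≤-trans (ℤ.≤-reflexive (sym (ℤ.+-identityʳ i))) (ℤ.+-monoʳ-≤ i 0≤j)

i≤nonneg+i : ∀ i {j} → + 0 ≤ℤ j → i ≤ℤ j + i
i≤nonneg+i i {j} 0≤j = ℤ.≤-trans (i≤i+nonneg i 0≤j) (ℤ.≤-reflexive (ℤ.+-comm i j))

term≤sumFin : ∀ {n} {f : Fin n → ℤ} → (∀ k → + 0 ≤ℤ f k) → ∀ a → f a ≤ℤ sumFin f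
term≤sumFin f≥0 zero    = i≤i+nonneg _ (sumFin-nonneg (f≥0 ∘ suc))
term≤sumFin f≥0 (suc a) = ℤ.≤-trans (term≤sumFin (f≥0 ∘ suc) a) (i≤nonneg+i _ (f≥0 zero))

pair≤sumFin : ∀ {n} {f : Fin n → ℤ} → (∀ k → + 0 ≤ℤ f k) → ∀ a c → a ≢ c → f a + f c ≤ℤ sumFin f
pair≤sumFin         f≥0 zero    zero    a≢c = ⊥-elim (a≢c refl)
pair≤sumFin {f = f} f≥0 zero    (suc c) _   = ℤ.+-monoʳ-≤ (f zero) (term≤sumFin (f≥0 ∘ suc) c)
pair≤sumFin {f = f} f≥0 (suc a) zero    _   =
  ℤ.≤-trans (ℤ.≤-reflexive (ℤ.+-comm (f (suc a)) (f zero)))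
            (ℤ.+-monoʳ-≤ (f zero) (term≤sumFin (f≥0 ∘ suc) a))
pair≤sumFin         f≥0 (suc a) (suc c) a≢c =
  ℤ.≤-trans (pair≤sumFin (f≥0 ∘ suc) a c (a≢c ∘ cong suc)) (i≤nonneg+i _ (f≥0 zero))

ZeroOne-sumFin≡1-unique : ∀ {n} {f : Fin n → ℤ} → (∀ k → ZeroOne (f k)) → sumFin f ≡ + 1 →
  ∀ {a c} → f a ≡ + 1 → f c ≡ + 1 → a ≡ c
ZeroOne-sumFin≡1-unique f01 Σf≡1 {a} {c} fa≡1 fc≡1 with a ≟ c
... | yes a≡c = a≡c
... | no a≢c  = ⊥-elim (2≰1 (subst₂ _≤ℤ_ (cong₂ _+_ fa≡1 fc≡1) Σf≡1
                               (pair≤sumFin (ZeroOne⇒0≤ ∘ f01) a c a≢c)))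
  where
  2≰1 : ¬ (+ 2 ≤ℤ + 1)
  2≰1 (+≤+ (s≤s ()))

Proper⇒cell≡δ : ∀ {n} {f : Sq n} → Proper f → ∀ {i j a} → f i j a ≡ + 1 → ∀ z → f i j z ≡ δ z a
Proper⇒cell≡δ ((cells , _ , _) , f01) {i} {j} {a} fija≡1 z with z ≟ a
... | yes refl = fija≡1
... | no z≢a with f01 i j z
...   | inj₁ fijz≡0 = fijz≡0
...   | inj₂ fijz≡1 = ⊥-elim (z≢a (ZeroOne-sumFin≡1-unique (f01 i j) (cells i j) fijz≡1 fija≡1))

Proper-column-unique : ∀ {n} {f : Sq n} → Proper f → ∀ {i j j' a} →
  f i j a ≡ + 1 → f i j' a ≡ + 1 → j ≡ j'
Proper-column-unique ((_ , rows , _) , f01) {i} {a = a} =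
  ZeroOne-sumFin≡1-unique (λ j → f01 i j a) (rows i a)

toℕ-cyc : ∀ {r} (k : Fin (suc r)) → suc (toℕ k) < suc r → toℕ (cyc k) ≡ suc (toℕ k)
toℕ-cyc {r} k k+1<r with suc (toℕ k) <? suc r
... | yes k+1<r' = toℕ-fromℕ< k+1<r'
... | no  k+1≮r  = ⊥-elim (k+1≮r k+1<r)

cyc-last : ∀ {r} (k : Fin (suc r)) → toℕ k ≡ r → cyc k ≡ zero
cyc-last {r} k k≡r with suc (toℕ k) <? suc r
... | yes k+1<r = ⊥-elim (<-irrefl refl (subst (λ s → suc s < suc r) k≡r k+1<r))
... | no  _     = refl

cyc-≢ : ∀ {r} (k : Fin (suc (suc r))) → cyc k ≢ k
cyc-≢ {r} k with suc (toℕ k) <? suc (suc r)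
... | yes k+1<r = λ eq → 1+n≢n (trans (sym (toℕ-fromℕ< k+1<r)) (cong toℕ eq))
... | no  k+1≮r = λ zero≡k → k+1≮r (subst (λ s → suc (toℕ s) < suc (suc r)) zero≡k (s≤s (s≤s z≤n)))

cyc^ : ∀ {r} → ℕ → Fin (suc r)
cyc^ zero    = zero
cyc^ (suc t) = cyc (cyc^ t)

toℕ-cyc^ : ∀ {r} t → t < suc r → toℕ (cyc^ {r} t) ≡ t
toℕ-cyc^ zero    _     = refl
toℕ-cyc^ {r} (suc t) t+1<r =
  trans (toℕ-cyc (cyc^ t) (subst (λ s → suc s < _) (sym ih) t+1<r)) (cong suc ih)
  where
  ih : toℕ (cyc^ {r} t) ≡ t
  ih = toℕ-cyc^ t (<-trans (n<1+n t) t+1<r)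

≡-via-toℕ : ∀ {r s} {u v : Fin r} → toℕ v ≡ s → toℕ u ≡ s → u ≡ v
≡-via-toℕ ∣v∣≡s ∣u∣≡s = toℕ-injective (trans ∣u∣≡s (sym ∣v∣≡s))

≢-via-toℕ : ∀ {r s} {u v : Fin r} → toℕ v ≡ s → toℕ u ≢ s → u ≢ v
≢-via-toℕ ∣v∣≡s ∣u∣≢s u≡v = ∣u∣≢s (trans (cong toℕ u≡v) ∣v∣≡s)

i+j-i≡j : ∀ i j → i + j - i ≡ j
i+j-i≡j = solve-∀

i+j-j≡i : ∀ i j → i + j - j ≡ i
i+j-j≡i = solve-∀

Steps-snoc : ∀ {X : Set} {R : X → X → Set} {k f g h} → Steps R k f g → R g h → Steps R (suc k) f h
Steps-snoc done                 g→h = step g→h done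
Steps-snoc (step f→f' f'→*g) g→h = step f→f' (Steps-snoc f'→*g g→h)

module RotateCycle
  (n : ℕ) (A : Sq n) (A-proper : Proper A) (i₁ i₂ : Fin n) (i₁≢i₂ : i₁ ≢ i₂) (q : ℕ)
  (cols : Fin (suc (suc q)) → Fin n) (cols-injective : ∀ k k' → cols k ≡ cols k' → k ≡ k')
  (x : Fin (suc (suc q)) → Fin n)
  (A-row₁ : ∀ k → A i₁ (cols k) (x k) ≡ + 1) (A-row₂ : ∀ k → A i₂ (cols k) (x (cyc k)) ≡ + 1)
  where

  r : ℕ
  r = suc (suc q)

  A-row₁-δ : ∀ m z → A i₁ (cols m) z ≡ δ z (x m)
  A-row₁-δ m = Proper⇒cell≡δ A-proper (A-row₁ m)

  A-row₂-δ : ∀ m z → A i₂ (cols m) z ≡ δ z (x (cyc m))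
  A-row₂-δ m = Proper⇒cell≡δ A-proper (A-row₂ m)

  x-injective : ∀ k k' → x k ≡ x k' → k ≡ k'
  x-injective k k' xk≡xk' = cols-injective k k' (Proper-column-unique A-proper (A-row₁ k)
    (subst (λ s → A i₁ (cols k') s ≡ + 1) (sym xk≡xk') (A-row₁ k')))

  x₀≢x : ∀ {t} m → toℕ m ≡ suc t → x zero ≢ x m
  x₀≢x m m≡t+1 x0≡xm = 1+n≢0 (trans (sym m≡t+1) (cong toℕ (x-injective m zero (sym x0≡xm))))

  row₁ : ℕ → Fin r → Fin n
  row₁ t m with <-cmp (toℕ m) t
  ... | tri< _ _ _ = x (cyc m)
  ... | tri≈ _ _ _ = x zero
  ... | tri> _ _ _ = x m

  row₁-< : ∀ {t m} → toℕ m < t → row₁ t m ≡ x (cyc m)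
  row₁-< {t} {m} m<t with <-cmp (toℕ m) t
  ... | tri< _ _ _   = refl
  ... | tri≈ m≮t _ _ = ⊥-elim (m≮t m<t)
  ... | tri> m≮t _ _ = ⊥-elim (m≮t m<t)

  row₁-≡ : ∀ {t m} → toℕ m ≡ t → row₁ t m ≡ x zero
  row₁-≡ {t} {m} m≡t with <-cmp (toℕ m) t
  ... | tri< _ m≢t _ = ⊥-elim (m≢t m≡t)
  ... | tri≈ _ _ _   = refl
  ... | tri> _ m≢t _ = ⊥-elim (m≢t m≡t)

  row₁-zero : ∀ m → row₁ 0 m ≡ x m
  row₁-zero m with <-cmp (toℕ m) 0
  ... | tri≈ _ m≡0 _ = cong x (sym (toℕ-injective m≡0))
  ... | tri> _ _ _   = refl

  row₁-final : ∀ m → row₁ (suc q) m ≡ x (cyc m)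
  row₁-final m with <-cmp (toℕ m) (suc q)
  ... | tri< _ _ _     = refl
  ... | tri≈ _ m≡q+1 _ = cong x (sym (cyc-last m m≡q+1))
  ... | tri> _ _ q+1<m = ⊥-elim (<⇒≱ q+1<m (≤-pred (toℕ<n m)))

  row₁-step : ∀ t m z → suc t < r →
    δ z (row₁ (suc t) m) ≡
    δ z (row₁ t m) + δ± m (cyc^ t) (cyc^ (suc t)) * δ± z (x (cyc^ (suc t))) (x zero)
  row₁-step t m z t+1<r
    with <-cmp (toℕ m) t | toℕ-cyc^ t (<-trans (n<1+n t) t+1<r) | toℕ-cyc^ (suc t) t+1<r
  ... | tri< m<t _ _ | ∣p∣ | ∣p'∣
    rewrite row₁-< (<-trans m<t (n<1+n t))
          | δ±-≢≢ (≢-via-toℕ ∣p∣ (<⇒≢ m<t)) (≢-via-toℕ ∣p'∣ (<⇒≢ (<-trans m<t (n<1+n t))))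
    = sym (ℤ.+-identityʳ _)
  ... | tri≈ _ m≡t _ | ∣p∣ | ∣p'∣
    rewrite row₁-< (subst (_< suc t) (sym m≡t) (n<1+n t))
          | δ±-≡≢ (≡-via-toℕ ∣p∣ m≡t) (≢-via-toℕ ∣p'∣ (λ m≡t+1 → 1+n≢n (trans (sym m≡t+1) m≡t)))
    = trans (cong (λ s → δ z (x (cyc s))) (≡-via-toℕ ∣p∣ m≡t))
            (enter (δ z (x zero)) (δ z (x (cyc^ (suc t)))))
    where
    enter : ∀ b c → c ≡ b + + 1 * (c - b)
    enter = solve-∀
  ... | tri> _ _ t<m | ∣p∣ | ∣p'∣ with <-cmp (toℕ m) (suc t)
  ...   | tri< m<t+1 _ _ = ⊥-elim (<⇒≱ t<m (≤-pred m<t+1))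
  ...   | tri≈ _ m≡t+1 _
    rewrite δ±-≢≡ (≢-via-toℕ ∣p∣ (<⇒≢ t<m ∘ sym)) (≡-via-toℕ ∣p'∣ m≡t+1)
    = trans (leave (δ z (x m)) (δ z (x zero)))
            (cong (λ s → δ z (x m) + - + 1 * (δ z (x s) - δ z (x zero))) (≡-via-toℕ ∣p'∣ m≡t+1))
    where
    leave : ∀ a c → c ≡ a + - + 1 * (a - c)
    leave = solve-∀
  ...   | tri> _ m≢t+1 _
    rewrite δ±-≢≢ (≢-via-toℕ ∣p∣ (<⇒≢ t<m ∘ sym)) (≢-via-toℕ ∣p'∣ m≢t+1)
    = sym (ℤ.+-identityʳ _)

  move : ℕ → Sq n
  move t = Δ i₁ i₂ (cols (cyc^ t)) (cols (cyc^ (suc t))) (x (cyc^ (suc t))) (x zero)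

  stage : ℕ → Sq n
  stage zero          = A
  stage (suc t) i j z = stage t i j z + move t i j z

  shift : ℕ → Fin n → Fin n → ℤ
  shift zero    j z = + 0
  shift (suc t) j z =
    shift t j z + δ± j (cols (cyc^ t)) (cols (cyc^ (suc t))) * δ± z (x (cyc^ (suc t))) (x zero)

  stage≡A+shift : ∀ t i j z → stage t i j z ≡ A i j z + δ± i i₁ i₂ * shift t j z
  stage≡A+shift zero    i j z = no-shift (A i j z) (δ± i i₁ i₂)
    where
    no-shift : ∀ a d → a ≡ a + d * + 0
    no-shift = solve-∀
  stage≡A+shift (suc t) i j z
    rewrite stage≡A+shift t i j z
          | Δ≡δ±-product i₁ i₂ (cols (cyc^ t)) (cols (cyc^ (suc t))) (x (cyc^ (suc t))) (x zero)
                         i j z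
    = collect (A i j z) (δ± i i₁ i₂) (shift t j z) (δ± j (cols (cyc^ t)) (cols (cyc^ (suc t))))
              (δ± z (x (cyc^ (suc t))) (x zero))
    where
    collect : ∀ a d s D W → (a + d * s) + d * (D * W) ≡ a + d * (s + D * W)
    collect = solve-∀

  shift-cols : ∀ t → t < r → ∀ m z → shift t (cols m) z ≡ δ z (row₁ t m) - δ z (x m)
  shift-cols zero    _   m z rewrite row₁-zero m = sym (ℤ.+-inverseʳ (δ z (x m)))
  shift-cols (suc t) t<r m z
    rewrite shift-cols t (<-trans (n<1+n t) t<r) m z
          | δ-map-injective cols-injective m (cyc^ t)
          | δ-map-injective cols-injective m (cyc^ (suc t))
          | row₁-step t m z t<r
    = telescope (δ z (row₁ t m)) (δ z (x m))
                (δ± m (cyc^ t) (cyc^ (suc t)) * δ± z (x (cyc^ (suc t))) (x zero))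
    where
    telescope : ∀ R X D → (R - X) + D ≡ (R + D) - X
    telescope = solve-∀

  shift-off : ∀ t j z → (∀ m → j ≢ cols m) → shift t j z ≡ + 0
  shift-off zero    j z _     = refl
  shift-off (suc t) j z j∉cols
    rewrite shift-off t j z j∉cols
          | δ±-≢≢ (j∉cols (cyc^ t)) (j∉cols (cyc^ (suc t)))
    = refl

  stage-row₁ : ∀ t → t < r → ∀ m z → stage t i₁ (cols m) z ≡ δ z (row₁ t m)
  stage-row₁ t t<r m z
    rewrite stage≡A+shift t i₁ (cols m) z | A-row₁-δ m z
          | δ±-≡≢ refl i₁≢i₂ | shift-cols t t<r m z
    = cancel (δ z (row₁ t m)) (δ z (x m))
    where
    cancel : ∀ R X → X + + 1 * (R - X) ≡ R
    cancel = solve-∀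

  stage-row₂ : ∀ t → t < r → ∀ m z →
    stage t i₂ (cols m) z ≡ δ z (x (cyc m)) + δ z (x m) - δ z (row₁ t m)
  stage-row₂ t t<r m z
    rewrite stage≡A+shift t i₂ (cols m) z | A-row₂-δ m z
          | δ±-≢≡ (i₁≢i₂ ∘ sym) (refl {x = i₂}) | shift-cols t t<r m z
    = reflect (δ z (x (cyc m))) (δ z (row₁ t m)) (δ z (x m))
    where
    reflect : ∀ C R X → C + - + 1 * (R - X) ≡ C + X - R
    reflect = solve-∀

  stage-outside : ∀ t i j z → ¬ InBlock i₁ i₂ cols i j → stage t i j z ≡ A i j z
  stage-outside t i j z ∉block =
    trans (stage≡A+shift t i j z) (trans (cong (_+_ (A i j z)) offset≡0) (ℤ.+-identityʳ (A i j z)))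
    where
    offset≡0 : δ± i i₁ i₂ * shift t j z ≡ + 0
    offset≡0 with i ≟ i₁ ⊎-dec i ≟ i₂
    ... | yes i∈rows =
      trans (cong (δ± i i₁ i₂ *_) (shift-off t j z (λ m j≡ → ∉block (i∈rows , m , j≡))))
            (ℤ.*-zeroʳ (δ± i i₁ i₂))
    ... | no i∉rows  = cong (_* shift t j z) (δ±-≢≢ (i∉rows ∘ inj₁) (i∉rows ∘ inj₂))

  stage-LineSums : ∀ t → LineSums (stage t)
  stage-LineSums zero    = proj₁ A-proper
  stage-LineSums (suc t) =
    LineSums-+Δ i₁ i₂ (cols (cyc^ t)) (cols (cyc^ (suc t))) (x (cyc^ (suc t))) (x zero)
      (stage-LineSums t) (λ _ _ _ → refl)

  row₂-ZeroOne : ∀ t m z → (toℕ m ≡ t → cyc m ≢ zero → z ≢ x zero) →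
    ZeroOne (δ z (x (cyc m)) + δ z (x m) - δ z (row₁ t m))
  row₂-ZeroOne t m z active-ok with <-cmp (toℕ m) t
  ... | tri< _ _ _ =
    subst ZeroOne (sym (i+j-i≡j (δ z (x (cyc m))) (δ z (x m)))) (δ-ZeroOne z (x m))
  ... | tri> _ _ _ =
    subst ZeroOne (sym (i+j-j≡i (δ z (x (cyc m))) (δ z (x m)))) (δ-ZeroOne z (x (cyc m)))
  ... | tri≈ _ m≡t _ with cyc m ≟ zero
  ...   | yes cyc-m≡0 =
    subst (λ s → ZeroOne (δ z (x s) + δ z (x m) - δ z (x zero))) (sym cyc-m≡0)
          (subst ZeroOne (sym (i+j-i≡j (δ z (x zero)) (δ z (x m)))) (δ-ZeroOne z (x m)))
  ...   | no cyc-m≢0  = δ+δ-δ-ZeroOne (cyc-≢ m ∘ x-injective (cyc m) m) (active-ok m≡t cyc-m≢0)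

  -- The hypothesis exempts the one cell that may hold −1: symbol x 0 in row i₂ of the active column.
  stage-ZeroOne : ∀ t → t < r → ∀ i j z →
    (∀ m → toℕ m ≡ t → i ≡ i₂ → j ≡ cols m → cyc m ≢ zero → z ≢ x zero) →
    ZeroOne (stage t i j z)
  stage-ZeroOne t t<r i j z active-ok with any? (λ m → j ≟ cols m)
  ... | no j∉cols =
    subst ZeroOne (sym (stage-outside t i j z (j∉cols ∘ proj₂))) (proj₂ A-proper i j z)
  ... | yes (m , refl) with i ≟ i₁ | i ≟ i₂
  ...   | yes refl | _        = subst ZeroOne (sym (stage-row₁ t t<r m z)) (δ-ZeroOne z (row₁ t m))
  ...   | no _     | yes refl = subst ZeroOne (sym (stage-row₂ t t<r m z))
                                  (row₂-ZeroOne t m z (λ m≡t → active-ok m m≡t refl refl))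
  ...   | no i≢i₁  | no i≢i₂  =
    subst ZeroOne (sym (stage-outside t i (cols m) z ∉block)) (proj₂ A-proper i (cols m) z)
    where
    ∉block : ¬ InBlock i₁ i₂ cols i (cols m)
    ∉block (i∈rows , _) = [ i≢i₁ , i≢i₂ ] i∈rows

  stage-final-Proper : Proper (stage (suc q))
  stage-final-Proper =
    stage-LineSums (suc q) ,
    λ i j z → stage-ZeroOne (suc q) ≤-refl i j z
                (λ m m≡q+1 _ _ cyc-m≢0 → ⊥-elim (cyc-m≢0 (cyc-last m m≡q+1)))

  stage-InS : ∀ t → t ≤ q → InS (stage (suc t))
  stage-InS t t≤q with t ≟ℕ q
  ... | yes refl = inj₁ stage-final-Proper
  ... | no t≢q   =
    inj₂ (stage-LineSums (suc t) , i₂ , cols p , x zero , p-cell ,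
          λ i j z ¬bad → stage-ZeroOne (suc t) t+1<r i j z
            (λ m m≡t+1 i≡i₂ j≡ _ z≡ →
               ¬bad (i≡i₂ , trans j≡ (cong cols (≡-via-toℕ ∣p∣ m≡t+1)) , z≡)))
    where
    p : Fin r
    p = cyc^ (suc t)
    t+1<r : suc t < r
    t+1<r = s≤s (s≤s t≤q)
    ∣p∣ : toℕ p ≡ suc t
    ∣p∣ = toℕ-cyc^ (suc t) t+1<r
    ∣cyc-p∣ : toℕ (cyc p) ≡ suc (suc t)
    ∣cyc-p∣ = toℕ-cyc^ (suc (suc t)) (s≤s (s≤s (≤∧≢⇒< t≤q t≢q)))
    p-cell : stage (suc t) i₂ (cols p) (x zero) ≡ -[1+ 0 ]
    p-cell
      rewrite stage-row₂ (suc t) t+1<r p (x zero) | row₁-≡ ∣p∣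
            | δ-≢ (x₀≢x (cyc p) ∣cyc-p∣) | δ-≢ (x₀≢x p ∣p∣)
            | δ-≡ (refl {x = x zero})
      = refl

  stage-move : ∀ t → t ≤ q → BlockMove i₁ i₂ cols (stage t) (stage (suc t))
  stage-move t t≤q =
    i₁ , i₂ , cols p , cols p' , x p' , x zero , inj₁ (refl , refl) , (p , refl) , (p' , refl) ,
    i₁≢i₂ ,
    (λ cols-p≡ → 1+n≢n (trans (sym ∣p'∣)
                              (trans (cong toℕ (sym (cols-injective p p' cols-p≡))) ∣p∣))) ,
    (x₀≢x p' ∣p'∣ ∘ sym) ,
    (λ _ _ _ → refl) ,
    stage-InS t t≤q
    where
    p p' : Fin r
    p  = cyc^ t
    p' = cyc^ (suc t)
    ∣p∣ : toℕ p ≡ t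
    ∣p∣ = toℕ-cyc^ t (s≤s (≤-trans t≤q (n≤1+n q)))
    ∣p'∣ : toℕ p' ≡ suc t
    ∣p'∣ = toℕ-cyc^ (suc t) (s≤s (s≤s t≤q))

  stages : ∀ t → t ≤ suc q → Steps (BlockMove i₁ i₂ cols) t A (stage t)
  stages zero    _       = done
  stages (suc t) t+1≤q+1 =
    Steps-snoc (stages t (≤-trans (n≤1+n t) t+1≤q+1)) (stage-move t (≤-pred t+1≤q+1))

  stage-final-row₁ : ∀ k → stage (suc q) i₁ (cols k) (x (cyc k)) ≡ + 1
  stage-final-row₁ k = trans (stage-row₁ (suc q) ≤-refl k (x (cyc k))) (δ-≡ (sym (row₁-final k)))

  stage-final-row₂ : ∀ k → stage (suc q) i₂ (cols k) (x k) ≡ + 1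
  stage-final-row₂ k
    rewrite stage-row₂ (suc q) ≤-refl k (x k) | row₁-final k
    = trans (i+j-i≡j (δ (x k) (x (cyc k))) (δ (x k) (x k))) (δ-≡ refl)

lemma2 : (n : ℕ) (A : Sq n) → Proper A →
    (i₁ i₂ : Fin n) → i₁ ≢ i₂ →
    (r : ℕ) → 2 ≤ r →
    (cols : Fin r → Fin n) → (∀ k k' → cols k ≡ cols k' → k ≡ k') →
    (x : Fin r → Fin n) →
    (∀ k → A i₁ (cols k) (x k) ≡ + 1) →
    (∀ k → A i₂ (cols k) (x (cyc k)) ≡ + 1) →
    Σ (Sq n) λ A' →
      Steps (BlockMove i₁ i₂ cols) (r ∸ 1) A A' ×
      Proper A' ×
      (∀ i j z → ¬ InBlock i₁ i₂ cols i j → A' i j z ≡ A i j z) ×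
      (∀ k → A' i₁ (cols k) (x (cyc k)) ≡ + 1) ×
      (∀ k → A' i₂ (cols k) (x k) ≡ + 1)
lemma2 _ _ _ _ _ _ (suc zero) (s≤s ()) _ _ _ _ _
lemma2 n A A-proper i₁ i₂ i₁≢i₂ (suc (suc q)) _ cols cols-injective x A-row₁ A-row₂ =
  stage (suc q) , stages (suc q) ≤-refl , stage-final-Proper ,
  stage-outside (suc q) , stage-final-row₁ , stage-final-row₂
  where open RotateCycle n A A-proper i₁ i₂ i₁≢i₂ q cols cols-injective x A-row₁ A-row₂
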